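{- Let $G$ be a $3$-edge-connected undirected graph (possibly with multiple edges) and $T$ a DFS spanning tree of $G$ rooted at $r$. Let $v$ be a vertex with $l_1(M(v))\geq v$, let $m=M_{low2}(v)$, and let $u$ be the minimum vertex in $M^{ -1}(m)$ strictly greater than $v$. Then there exists a back-edge $e$ such that $B(v)=B(u)\sqcup\{e\}$ if and only if: $\mathit{b\_count}(v)=\mathit{b\_count}(u)+1$, $\mathit{low2}(M_{low1}(v))\geq v$, and either $M(v)$ has no $\mathit{low3}$ child or $\mathit{low1}(c_3(M(v)))\geq v$.
   Context: Vertices are identified with their DFS preorder numbers. A vertex $u$ is an ancestor of $v$ ($v$ a descendant of $u$) if the tree path from $r$ to $v$ contains $u$ (every vertex is an ancestor and descendant of itself). $T(v)$ denotes the set of descendants of $v$. Non-tree edges are back-edges; a back-edge is written $(x,y)$ with $x$ a descendant of $y$. $B(v)$ is the set of back-edges $(x,y)$ with $x$ a descendant of $v$ and $y$ a proper ancestor of $v$, and $\mathit{b\_count}(v)=|B(v)|$; $\sqcup$ denotes disjoint union. $l_1(v)$ is the smallest $y$ such that there is a back-edge $(v,y)$, or $v$ if none. For $v\neq r$, $\mathit{low1}(v)=\min\{y:\exists (x,y)\in B(v)\}$, $\mathit{low1D}(v)$ is a vertex $x$ such that $(x,\mathit{low1}(v))\in B(v)$ (a specific such back-edge being fixed), and $\mathit{low2}(v)$ is the minimum $y$ such that there is a back-edge $(x,y)\in B(v)$ other than the fixed back-edge $(\mathit{low1D}(v),\mathit{low1}(v))$. The children of a vertex $w$ sorted in non-decreasing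 order of $\mathit{low1}$ are $c_1(w),c_2(w),c_3(w),\dots$ (ties broken arbitrarily but fixed; $c_i(w)=\emptyset$ if $w$ has fewer than $i$ children); $c_3(w)$ is the $\mathit{low3}$ child of $w$. $\mathit{nca}$ denotes nearest common ancestor in $T$. $M(v)=\mathit{nca}\{x:\exists(x,y)\in B(v)\}$; $M_{low1}(v)=\mathit{nca}\{x:\exists(x,y)\in B(v),\ x\in T(c_1(M(v)))\}$; $M_{low2}(v)=\mathit{nca}\{x:\exists(x,y)\in B(v),\ x\in T(c_2(M(v)))\}$ (each undefined if the set is empty). For a vertex $m$, $M^{ -1}(m)=\{w: M(w)=m\}$. -}

module Defs where

open import Data.Nat using (ℕ; zero; suc; _≤ᵇ_)
open import Data.Fin using (Fin; zero; suc; toℕ; _≤_; _<_; _≟_)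
open import Data.Fin.Properties using ()
open import Data.List using (List; []; _∷_; map; filterᵇ; foldl)
open import Data.List.Membership.Propositional using (_∈_)
open import Data.List.Relation.Unary.Unique.Propositional using (Unique)
open import Data.List.Relation.Unary.Linked using (Linked)
open import Data.Bool using (Bool; true; false; T; _∧_; _∨_; not; if_then_else_)
open import Data.Maybe using (Maybe; just; nothing; _>>=_)
open import Data.Product using (Σ; _×_; _,_)
open import Data.Sum using (_⊎_)
open import Relation.Binary.PropositionalEquality using (_≡_; _≢_)
open import Relation.Nullary.Decidable using (⌊_⌋)
open import Function.Bundles using (_⇔_)

-- Rooted spanning tree on the vertex set Fin (suc n); the root r is
-- vertex zero, every non-root vertex is (suc i) with parent (parent i).
-- Vertices are identified with their DFS preorder numbers.

record RootedTree : Set where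
  field
    n       : ℕ
    parent  : Fin n → Fin (suc n)
    parent< : ∀ i → parent i < suc i

module TreeOps (Tr : RootedTree) where
  open RootedTree Tr public

  V : Set
  V = Fin (suc n)

  _==_ : V → V → Bool
  a == b = ⌊ a ≟ b ⌋

  isAnc' : ℕ → V → V → Bool
  isAnc' f       u zero    = u == zero
  isAnc' zero    u (suc i) = u == suc i
  isAnc' (suc f) u (suc i) = (u == suc i) ∨ isAnc' f u (parent i)

  -- u is an ancestor of v (reflexive); suc n parent steps always suffice
  isAnc : V → V → Bool
  isAnc = isAnc' (suc n)

  Anc : V → V → Set
  Anc u v = T (isAnc u v)

  isPAnc : V → V → Bool
  isPAnc u v = isAnc u v ∧ not (u == v)

  PAnc : V → V → Set
  PAnc u v = T (isPAnc u v)

  IsChild : V → V → Set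
  IsChild w c = Σ (Fin n) λ i → (c ≡ suc i) × (parent i ≡ w)

  -- vertices are numbered in preorder: every subtree T(a) is the
  -- contiguous interval of numbers starting at a
  Preorder : Set
  Preorder = ∀ (a b c : V) → a ≤ b → b ≤ c → Anc a c → Anc a b

  minV : V → V → V
  minV a b = if toℕ a ≤ᵇ toℕ b then a else b

  minimumV : V → List V → V
  minimumV d []       = d
  minimumV d (x ∷ xs) = foldl minV x xs

  allV : List V
  allV = Data.List.allFin (suc n)
    where import Data.List

  -- nearest common ancestor of a nonempty list of vertices: the deepest
  -- common ancestor, i.e. (ancestors having smaller preorder numbers than
  -- their proper descendants) the common ancestor with largest number
  allL : (V → Bool) → List V → Bool
  allL p []       = true
  allL p (x ∷ xs) = p x ∧ allL p xs

  ncaL : List V → Maybe V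
  ncaL []         = nothing
  ncaL xs@(_ ∷ _) = just (foldl (λ acc w → if allL (isAnc w) xs then w else acc) zero allV)

-- A graph G given together with a DFS spanning tree T of G:
-- the edges of G are the tree edges (suc i, parent i), i : Fin n, and the
-- back-edges (tail j, head j), j : Fin k, with head j a proper ancestor of
-- tail j (every non-tree edge of a DFS tree is a back-edge).  Parallel
-- edges are allowed (repeated back-edges, back-edges parallel to tree edges).

record DFSGraph : Set where
  field
    tree     : RootedTree
  open TreeOps tree
  field
    preorder : Preorder
    k        : ℕ
    tail     : Fin k → V
    head     : Fin k → V
    backEdge : ∀ j → PAnc (head j) (tail j)

module GraphOps (G : DFSGraph) where
  open DFSGraph G public
  open TreeOps tree public

  Edge : Set
  Edge = Fin n ⊎ Fin k

  end₁ end₂ : Edge → V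
  end₁ (Data.Sum.inj₁ i) = suc i
  end₁ (Data.Sum.inj₂ j) = tail j
  end₂ (Data.Sum.inj₁ i) = parent i
  end₂ (Data.Sum.inj₂ j) = head j

  Joins : Edge → V → V → Set
  Joins e a b = ((end₁ e ≡ a) × (end₂ e ≡ b)) ⊎ ((end₂ e ≡ a) × (end₁ e ≡ b))

  data Conn (ok : Edge → Set) : V → V → Set where
    here : ∀ {a} → Conn ok a a
    step : ∀ {a b c} (e : Edge) → ok e → Joins e a b → Conn ok b c → Conn ok a c

  ThreeEdgeConnected : Set
  ThreeEdgeConnected =
    ∀ (e₁ e₂ : Edge) (a b : V) → Conn (λ e → (e ≢ e₁) × (e ≢ e₂)) a b

  inB : V → Fin k → Bool
  inB v j = isAnc v (tail j) ∧ isPAnc (head j) v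

  InB : V → Fin k → Set
  InB v j = T (inB v j)

  allE : List (Fin k)
  allE = Data.List.allFin k
    where import Data.List

  BL : V → List (Fin k)
  BL v = filterᵇ (inB v) allE

  b-count : V → ℕ
  b-count v = Data.List.length (BL v)
    where import Data.List

  -- l_1(v): smallest y with a back-edge (v , y), or v if none
  l1 : V → V
  l1 v = minimumV v (map head (filterᵇ (λ j → tail j == v) allE))

  -- low1(v) (v ≠ r); default v when B(v) = ∅ (never happens for v ≠ r
  -- in a 3-edge-connected graph)
  low1 : V → V
  low1 v = minimumV v (map head (BL v))

  firstWith : (Fin k → Bool) → List (Fin k) → Maybe (Fin k)
  firstWith p []       = nothing
  firstWith p (j ∷ js) = if p j then just j else firstWith p js

  -- the fixed back-edge (low1D(v), low1(v)): the first one in B(v)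
  low1Edge : V → Maybe (Fin k)
  low1Edge v = firstWith (λ j → head j == low1 v) (BL v)

  notFixed : Maybe (Fin k) → Fin k → Bool
  notFixed nothing  j = true
  notFixed (just e) j = not ⌊ j ≟ e ⌋
    where open import Data.Fin using (_≟_)

  -- low2(v); default v when undefined (never for v ≠ r, 3-edge-connected)
  low2 : V → V
  low2 v = minimumV v (map head (filterᵇ (notFixed (low1Edge v)) (BL v)))

  M : V → Maybe V
  M v = ncaL (map tail (BL v))

  nth : {A : Set} → List A → ℕ → Maybe A
  nth []       _       = nothing
  nth (x ∷ xs) zero    = just x
  nth (x ∷ xs) (suc i) = nth xs i

record ChildOrder (G : DFSGraph) : Set where
  open GraphOps G
  field
    children  : V → List V
    complete  : ∀ w c → (c ∈ children w) ⇔ IsChild w c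
    unique    : ∀ w → Unique (children w)
    sorted    : ∀ w → Linked (λ a b → toℕ (low1 a) Data.Nat.≤ toℕ (low1 b)) (children w)

module OrderOps (G : DFSGraph) (ord : ChildOrder G) where
  open GraphOps G public
  open ChildOrder ord public

  c₁ c₂ c₃ : V → Maybe V
  c₁ w = nth (children w) 0
  c₂ w = nth (children w) 1
  c₃ w = nth (children w) 2

  McT : V → V → Maybe V
  McT v c = ncaL (filterᵇ (isAnc c) (map tail (BL v)))

  Mlow1 : V → Maybe V
  Mlow1 v = M v >>= λ m → c₁ m >>= λ c → McT v c

  Mlow2 : V → Maybe V
  Mlow2 v = M v >>= λ m → c₂ m >>= λ c → McT v c

{-# OPTIONS --safe #-}
-- Since l₁(M(v)) ≥ v, no edge of B(v) leaves M(v) itself, so every edge of B(v) starts in the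
-- subtree of some child of M(v). Edges below c₂(M(v)) lie in B(u) (as u is an ancestor of
-- m = M_low2(v)), while B(u) has no edges below any other child. Hence B(v) ⊆ B(u) ⊔ {e} for
-- some e iff B(v) has exactly one edge below c₁(M(v)), which is what low2(M_low1(v)) ≥ v says,
-- and none below the later children, which (children being sorted by low1) is what
-- low1(c₃(M(v))) ≥ v says. Given the inclusion, b_count(v) = b_count(u) + 1 forces equality.
module Submission where

open import Defs
open import Data.Nat using (ℕ; zero; suc; _+_; _≤ᵇ_; z≤n; s≤s)
import Data.Nat as ℕ
open import Data.Nat.Base using (s≤s⁻¹)
open import Data.Nat.Properties
  using ( ≤-refl; ≤-reflexive; ≤-trans; <-trans; ≤-<-trans; <-≤-trans; <⇒≤; <⇒≱; ≰⇒>; ≮⇒≥; ≤⇒≯; n≮n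
        ; +-comm; +-mono-≤; +-cancelʳ-≤; +-commutativeSemigroup; ≤ᵇ⇒≤; ≤⇒≤ᵇ; module ≤-Reasoning)
open import Data.Nat.ListAction using (sum)
open import Data.Fin using (Fin; zero; suc; toℕ; _≟_; _≤_; _<_; _≤?_)
open import Data.Fin.Properties using (toℕ<n; ≤∧≢⇒<; <⇒≢)
import Data.Fin.Properties as Finₚ
open import Data.List using (List; []; _∷_; map; filterᵇ; foldl; length; tabulate; allFin)
open import Data.List.Properties using (map-tabulate; map-cong; tabulate-cong)
open import Data.List.Membership.Propositional using (_∈_)
open import Data.List.Membership.Propositional.Properties using (∈-allFin; ∈-map⁺; ∈-map⁻; ∈-filter⁺; ∈-filter⁻)
open import Data.List.Relation.Unary.Any using (here; there)
open import Data.List.Relation.Unary.All as All using ([]; _∷_)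
open import Data.List.Relation.Unary.AllPairs using (AllPairs; []; _∷_)
open import Data.List.Relation.Unary.AllPairs.Properties using (tabulate⁺-<)
open import Data.List.Relation.Unary.Linked using (Linked)
open import Data.List.Relation.Unary.Linked.Properties using (Linked⇒AllPairs)
open import Data.Bool using (Bool; true; false; T; if_then_else_)
open import Data.Bool.Properties using (T-∨; T-∧; T?)
open import Data.Maybe using (just; nothing; _>>=_)
open import Data.Maybe.Properties using (just-injective)
open import Data.Product using (Σ; ∃; _×_; _,_; proj₁; proj₂)
open import Data.Sum using (_⊎_; inj₁; inj₂; [_,_]; map₂)
open import Data.Empty using (⊥-elim)
open import Data.Unit using (tt)
open import Function using (_∘_; id)
open import Function.Bundles using (_⇔_; mk⇔; Equivalence)
open import Function.Construct.Composition using (_⇔-∘_)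
open import Relation.Nullary using (¬_; yes; no; contradiction)
open import Relation.Nullary.Decidable using (⌊_⌋; toWitness; fromWitness; toWitnessFalse; fromWitnessFalse)
open import Relation.Binary.PropositionalEquality
  using (_≡_; _≢_; refl; sym; trans; cong; cong₂; subst; module ≡-Reasoning)
open Equivalence using (to; from)

AtMostOne : {A : Set} → (A → Set) → Set
AtMostOne P = ∀ {i j} → P i → P j → i ≡ j

AtMostOne-cong : {A : Set} {P Q : A → Set} → (∀ {x} → P x ⇔ Q x) → AtMostOne P ⇔ AtMostOne Q
AtMostOne-cong P⇔Q = mk⇔ (λ amo {i} {j} q q′ → amo (from P⇔Q q) (from P⇔Q q′))
                         (λ amo {i} {j} p p′ → amo (to P⇔Q p) (to P⇔Q p′))

module Counting where

  𝟙 : Bool → ℕ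
  𝟙 true  = 1
  𝟙 false = 0

  1≤𝟙+𝟙 : ∀ {c d} → T c ⊎ T d → 1 ℕ.≤ 𝟙 c + 𝟙 d
  1≤𝟙+𝟙 {true}          _        = s≤s z≤n
  1≤𝟙+𝟙 {false} {true}  _        = s≤s z≤n
  1≤𝟙+𝟙 {false} {false} (inj₁ ())
  1≤𝟙+𝟙 {false} {false} (inj₂ ())

  𝟙+𝟙-mono : ∀ a b c d → (T a → T c ⊎ T d) → (T b → T c) → ¬ (T a × T b) → 𝟙 a + 𝟙 b ℕ.≤ 𝟙 c + 𝟙 d
  𝟙+𝟙-mono false false _ _ _   _   _ = z≤n
  𝟙+𝟙-mono false true  _ _ _   b→c _ = 1≤𝟙+𝟙 (inj₁ (b→c tt))
  𝟙+𝟙-mono true  false _ _ a→c _   _ = 1≤𝟙+𝟙 (a→c tt)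
  𝟙+𝟙-mono true  true  _ _ _   _   d = ⊥-elim (d (tt , tt))

  𝟙-≡-⊎ : ∀ a b c → (T a ⇔ (T b ⊎ T c)) → ¬ (T b × T c) → 𝟙 a ≡ 𝟙 b + 𝟙 c
  𝟙-≡-⊎ false false false _ _ = refl
  𝟙-≡-⊎ false true  c     h _ = ⊥-elim (from h (inj₁ tt))
  𝟙-≡-⊎ false false true  h _ = ⊥-elim (from h (inj₂ tt))
  𝟙-≡-⊎ true  true  true  _ d = ⊥-elim (d (tt , tt))
  𝟙-≡-⊎ true  true  false _ _ = refl
  𝟙-≡-⊎ true  false true  _ _ = refl
  𝟙-≡-⊎ true  false false h _ with to h tt
  ... | inj₁ ()
  ... | inj₂ ()

  module _ {A : Set} where

    length-filterᵇ : ∀ (p : A → Bool) xs → length (filterᵇ p xs) ≡ sum (map (𝟙 ∘ p) xs)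
    length-filterᵇ p []       = refl
    length-filterᵇ p (x ∷ xs) with p x
    ... | true  = cong suc (length-filterᵇ p xs)
    ... | false = length-filterᵇ p xs

    sum-map-mono : ∀ {f g : A → ℕ} → (∀ x → f x ℕ.≤ g x) → ∀ xs → sum (map f xs) ℕ.≤ sum (map g xs)
    sum-map-mono f≤g []       = z≤n
    sum-map-mono f≤g (x ∷ xs) = +-mono-≤ (f≤g x) (sum-map-mono f≤g xs)

    sum-map-+ : ∀ (f g : A → ℕ) xs → sum (map (λ x → f x + g x) xs) ≡ sum (map f xs) + sum (map g xs)
    sum-map-+ f g []       = refl
    sum-map-+ f g (x ∷ xs) = trans (cong (f x + g x +_) (sum-map-+ f g xs)) (interchange (f x) (g x) _ _)
      where open import Algebra.Properties.CommutativeSemigroup +-commutativeSemigroup using (interchange)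

  sum-𝟙-≟ : ∀ {k} (e : Fin k) → sum (map (λ x → 𝟙 ⌊ x ≟ e ⌋) (allFin k)) ≡ 1
  sum-𝟙-≟ e = trans (cong sum (map-tabulate id (λ x → 𝟙 ⌊ x ≟ e ⌋))) (go e)
    where
    zeros : ∀ {k} → sum (tabulate {n = k} (λ _ → 0)) ≡ 0
    zeros {zero}  = refl
    zeros {suc k} = zeros {k}
    go : ∀ {k} (e : Fin k) → sum (tabulate (λ x → 𝟙 ⌊ x ≟ e ⌋)) ≡ 1
    go {suc k} zero    = cong suc (zeros {k})
    go {suc k} (suc e) = trans (cong sum (tabulate-cong (λ x → cong 𝟙 (⌊suc≟suc⌋ x e)))) (go e)
      where
      -- not definitional: ⌊_⌋ is stuck on the map′ that _≟_ builds for suc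
      ⌊suc≟suc⌋ : ∀ {k} (x y : Fin k) → ⌊ suc x ≟ suc y ⌋ ≡ ⌊ x ≟ y ⌋
      ⌊suc≟suc⌋ x y with x ≟ y
      ... | yes _ = refl
      ... | no _  = refl

  count : ∀ {k} → (Fin k → Bool) → ℕ
  count {k} p = length (filterᵇ p (allFin k))

  module _ {k} {p q : Fin k → Bool} {e : Fin k} where

    count-insert : (∀ x → T (p x) ⇔ (T (q x) ⊎ x ≡ e)) → ¬ T (q e) → count p ≡ suc (count q)
    count-insert p⇔q+e e∉q = begin
      count p                                                  ≡⟨ length-filterᵇ p (allFin k) ⟩
      sum (map (𝟙 ∘ p) (allFin k))                             ≡⟨ cong sum (map-cong pointwise (allFin k)) ⟩
      sum (map (λ x → 𝟙 (q x) + 𝟙 ⌊ x ≟ e ⌋) (allFin k))       ≡⟨ sum-map-+ (𝟙 ∘ q) _ (allFin k) ⟩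
      sum (map (𝟙 ∘ q) (allFin k)) + sum (map (λ x → 𝟙 ⌊ x ≟ e ⌋) (allFin k))
                                                               ≡⟨ cong₂ _+_ (sym (length-filterᵇ q (allFin k))) (sum-𝟙-≟ e) ⟩
      count q + 1                                              ≡⟨ +-comm (count q) 1 ⟩
      suc (count q)                                            ∎
      where
      open ≡-Reasoning
      pointwise : ∀ x → 𝟙 (p x) ≡ 𝟙 (q x) + 𝟙 ⌊ x ≟ e ⌋
      pointwise x = 𝟙-≡-⊎ (p x) (q x) ⌊ x ≟ e ⌋
        (mk⇔ (λ px → map₂ fromWitness (to (p⇔q+e x) px))
             (λ { (inj₁ qx) → from (p⇔q+e x) (inj₁ qx) ; (inj₂ x≡e) → from (p⇔q+e x) (inj₂ (toWitness x≡e)) }))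
        (λ (qx , x≡e) → e∉q (subst (T ∘ q) (toWitness x≡e) qx))

    count≡suc⇒⊇ : (∀ x → T (p x) → T (q x) ⊎ x ≡ e) → count p ≡ suc (count q) → ∀ x → T (q x) → T (p x)
    count≡suc⇒⊇ p⊆q+e count≡ x₀ qx₀ with T? (p x₀)
    ... | yes px₀ = px₀
    ... | no ¬px₀ = ⊥-elim (n≮n (count q) (+-cancelʳ-≤ 1 _ _ (subst (λ n → n + 1 ℕ.≤ count q + 1) count≡ sums≤)))
      where
      open ≤-Reasoning
      pointwise : ∀ x → 𝟙 (p x) + 𝟙 ⌊ x ≟ x₀ ⌋ ℕ.≤ 𝟙 (q x) + 𝟙 ⌊ x ≟ e ⌋
      pointwise x = 𝟙+𝟙-mono (p x) ⌊ x ≟ x₀ ⌋ (q x) ⌊ x ≟ e ⌋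
        (map₂ fromWitness ∘ p⊆q+e x)
        (λ x≡x₀ → subst (T ∘ q) (sym (toWitness x≡x₀)) qx₀)
        (λ (px , x≡x₀) → ¬px₀ (subst (T ∘ p) (toWitness x≡x₀) px))
      sums≤ : count p + 1 ℕ.≤ count q + 1
      sums≤ = begin
        count p + 1                                              ≡⟨ cong₂ _+_ (length-filterᵇ p (allFin k)) (sym (sum-𝟙-≟ x₀)) ⟩
        sum (map (𝟙 ∘ p) (allFin k)) + sum (map (λ x → 𝟙 ⌊ x ≟ x₀ ⌋) (allFin k))
                                                                 ≡⟨ sum-map-+ (𝟙 ∘ p) _ (allFin k) ⟨
        sum (map (λ x → 𝟙 (p x) + 𝟙 ⌊ x ≟ x₀ ⌋) (allFin k))      ≤⟨ sum-map-mono pointwise (allFin k) ⟩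
        sum (map (λ x → 𝟙 (q x) + 𝟙 ⌊ x ≟ e ⌋) (allFin k))       ≡⟨ sum-map-+ (𝟙 ∘ q) _ (allFin k) ⟩
        sum (map (𝟙 ∘ q) (allFin k)) + sum (map (λ x → 𝟙 ⌊ x ≟ e ⌋) (allFin k))
                                                                 ≡⟨ cong₂ _+_ (sym (length-filterᵇ q (allFin k))) (sum-𝟙-≟ e) ⟩
        count q + 1                                              ∎

module MinimumV (Tr : RootedTree) where
  open TreeOps Tr

  minV∈ : ∀ a b → minV a b ≡ a ⊎ minV a b ≡ b
  minV∈ a b with toℕ a ≤ᵇ toℕ b
  ... | true  = inj₁ refl
  ... | false = inj₂ refl

  minV≤ : ∀ a b → minV a b ≤ a × minV a b ≤ b
  minV≤ a b with toℕ a ≤ᵇ toℕ b in eq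
  ... | true  = ≤-refl , ≤ᵇ⇒≤ (toℕ a) (toℕ b) (subst T (sym eq) tt)
  ... | false = <⇒≤ (≰⇒> (λ a≤b → subst T eq (≤⇒≤ᵇ a≤b))) , ≤-refl

  foldl-minV-∈ : ∀ a ys → foldl minV a ys ∈ a ∷ ys
  foldl-minV-∈ a []       = here refl
  foldl-minV-∈ a (y ∷ ys) with foldl-minV-∈ (minV a y) ys
  ... | there p = there (there p)
  ... | here eq with minV∈ a y
  ...   | inj₁ eq′ = here (trans eq eq′)
  ...   | inj₂ eq′ = there (here (trans eq eq′))

  foldl-minV-≤ : ∀ a ys {y} → y ∈ a ∷ ys → foldl minV a ys ≤ y
  foldl-minV-≤ a []       (here refl)         = ≤-refl
  foldl-minV-≤ a (y ∷ ys) (here refl)         = ≤-trans (foldl-minV-≤ (minV a y) ys (here refl)) (proj₁ (minV≤ a y))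
  foldl-minV-≤ a (y ∷ ys) (there (here refl)) = ≤-trans (foldl-minV-≤ (minV a y) ys (here refl)) (proj₂ (minV≤ a y))
  foldl-minV-≤ a (y ∷ ys) (there (there p))   = foldl-minV-≤ (minV a y) ys (there p)

  minimumV-∈ : ∀ d xs → minimumV d xs ∈ d ∷ xs
  minimumV-∈ d []       = here refl
  minimumV-∈ d (x ∷ xs) = there (foldl-minV-∈ x xs)

  minimumV-≤ : ∀ d xs {y} → y ∈ xs → minimumV d xs ≤ y
  minimumV-≤ d (x ∷ xs) p = foldl-minV-≤ x xs p

module Ancestry (Tr : RootedTree) where
  open TreeOps Tr

  infix 4 _⊑_
  data _⊑_ (u : V) : V → Set where
    here : u ⊑ u
    up   : ∀ {i} → u ⊑ parent i → u ⊑ suc i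

  parent≤ : ∀ i → toℕ (parent i) ℕ.≤ toℕ i
  parent≤ i = s≤s⁻¹ (parent< i)

  isAnc'-sound : ∀ f u v → T (isAnc' f u v) → u ⊑ v
  isAnc'-sound f       u zero    t = subst (u ⊑_) (toWitness t) here
  isAnc'-sound zero    u (suc i) t = subst (u ⊑_) (toWitness t) here
  isAnc'-sound (suc f) u (suc i) t with to T-∨ t
  ... | inj₁ u≡v = subst (u ⊑_) (toWitness u≡v) here
  ... | inj₂ u⊑p = up (isAnc'-sound f u (parent i) u⊑p)

  isAnc'-complete : ∀ f {u v} → toℕ v ℕ.≤ f → u ⊑ v → T (isAnc' f u v)
  isAnc'-complete f       {v = zero}  _       here   = tt
  isAnc'-complete zero    {v = suc i} _       here   = fromWitness {a? = suc i ≟ suc i} refl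
  isAnc'-complete (suc f) {v = suc i} _       here   = from T-∨ (inj₁ (fromWitness {a? = suc i ≟ suc i} refl))
  isAnc'-complete (suc f) {v = suc i} (s≤s b) (up p) =
    from T-∨ (inj₂ (isAnc'-complete f (≤-trans (parent≤ i) b) p))

  Anc⇔⊑ : ∀ {u v} → Anc u v ⇔ u ⊑ v
  Anc⇔⊑ {u} {v} = mk⇔ (isAnc'-sound (suc n) u v) (isAnc'-complete (suc n) (<⇒≤ (toℕ<n v)))

  PAnc⇔ : ∀ {u v} → PAnc u v ⇔ (u ⊑ v × u ≢ v)
  PAnc⇔ {u} {v} = mk⇔
    (λ t → let u⊑v , u≠v = to T-∧ t in to Anc⇔⊑ u⊑v , toWitnessFalse u≠v)
    (λ (u⊑v , u≢v) → from T-∧ (from Anc⇔⊑ u⊑v , fromWitnessFalse u≢v))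

  ⊑⇒≤ : ∀ {u v} → u ⊑ v → u ≤ v
  ⊑⇒≤ here       = ≤-refl
  ⊑⇒≤ (up {i} p) = ≤-trans (⊑⇒≤ p) (<⇒≤ (parent< i))

  ⊑-trans : ∀ {u v w} → u ⊑ v → v ⊑ w → u ⊑ w
  ⊑-trans p here   = p
  ⊑-trans p (up q) = up (⊑-trans p q)

  root⊑ : ∀ v → zero ⊑ v
  root⊑ v = go (toℕ v) v ≤-refl
    where
    go : ∀ f v → toℕ v ℕ.≤ f → zero ⊑ v
    go f       zero    _       = here
    go (suc f) (suc i) (s≤s b) = up (go f (parent i) (≤-trans (parent≤ i) b))

  ⊑-comparable : ∀ {u w x} → u ⊑ x → w ⊑ x → u ⊑ w ⊎ w ⊑ u
  ⊑-comparable here   q      = inj₂ q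
  ⊑-comparable (up p) here   = inj₁ (up p)
  ⊑-comparable (up p) (up q) = ⊑-comparable p q

  ⊑-<⇒⊑ : ∀ {u v x} → u ⊑ x → v ⊑ x → u < v → u ⊑ v
  ⊑-<⇒⊑ p q u<v with ⊑-comparable p q
  ... | inj₁ u⊑v = u⊑v
  ... | inj₂ v⊑u = contradiction (⊑⇒≤ v⊑u) (<⇒≱ u<v)

  child⊑ : ∀ {w c} → IsChild w c → w ⊑ c
  child⊑ (i , refl , refl) = up here

  child< : ∀ {w c} → IsChild w c → w < c
  child< (i , refl , refl) = parent< i

  ⊑-child : ∀ {w x} → w ⊑ x → w ≢ x → Σ V λ c → IsChild w c × c ⊑ x
  ⊑-child here w≢x = contradiction refl w≢x
  ⊑-child {w} (up {i} p) w≢x with w ≟ parent i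
  ... | yes refl = suc i , (i , refl , refl) , here
  ... | no w≢p   = let c , ch , q = ⊑-child p w≢p in c , ch , up q

  ⊑-parent : ∀ {w c u} → IsChild w c → u ⊑ c → u ≢ c → u ⊑ w
  ⊑-parent (i , refl , refl) here   u≢c = contradiction refl u≢c
  ⊑-parent (i , refl , refl) (up p) _   = p

  children-disjoint : ∀ {w c c' x} → IsChild w c → IsChild w c' → c ⊑ x → c' ⊑ x → c ≡ c'
  children-disjoint {c = c} {c'} ch ch' p q with c ≟ c'
  ... | yes c≡c' = c≡c'
  ... | no c≢c' with ⊑-comparable p q
  ...   | inj₁ c⊑c' = contradiction (⊑⇒≤ (⊑-parent ch' c⊑c' c≢c')) (<⇒≱ (child< ch))
  ...   | inj₂ c'⊑c = contradiction (⊑⇒≤ (⊑-parent ch c'⊑c (c≢c' ∘ sym))) (<⇒≱ (child< ch'))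

  T-allL : ∀ p xs → T (allL p xs) ⇔ (∀ {x} → x ∈ xs → T (p x))
  T-allL p []       = mk⇔ (λ _ ()) (λ _ → tt)
  T-allL p (y ∷ ys) = mk⇔
    (λ t → let py , pys = to T-∧ t in λ { (here refl) → py ; (there x∈) → to (T-allL p ys) pys x∈ })
    (λ h → from T-∧ (h (here refl) , from (T-allL p ys) (λ x∈ → h (there x∈))))

  module LastSatisfying (q : V → Bool) where

    pick : V → V → V
    pick acc w = if q w then w else acc

    foldl-pick-∈ : ∀ acc ys → foldl pick acc ys ∈ acc ∷ ys
    foldl-pick-∈ acc []       = here refl
    foldl-pick-∈ acc (y ∷ ys) with q y
    ... | true  = there (foldl-pick-∈ y ys)
    ... | false with foldl-pick-∈ acc ys
    ...   | here eq = here eq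
    ...   | there p = there (there p)

    foldl-pick-q : ∀ acc ys → T (q acc) → T (q (foldl pick acc ys))
    foldl-pick-q acc []       qacc = qacc
    foldl-pick-q acc (y ∷ ys) qacc with q y in eq
    ... | true  = foldl-pick-q y ys (subst T (sym eq) tt)
    ... | false = foldl-pick-q acc ys qacc

    foldl-pick-max : ∀ acc ys → AllPairs _<_ ys → ∀ {w} → w ∈ ys → T (q w) → w ≤ foldl pick acc ys
    foldl-pick-max acc (y ∷ ys) (y<ys ∷ _) (here refl) qy with q y
    ... | true with foldl-pick-∈ y ys
    ...   | here eq = ≤-reflexive (cong toℕ (sym eq))
    ...   | there p = <⇒≤ (All.lookup y<ys p)
    foldl-pick-max acc (y ∷ ys) (_ ∷ sorted) (there p) qw = foldl-pick-max (pick acc y) ys sorted p qw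

  record IsNCA (xs : List V) (r : V) : Set where
    field
      common  : ∀ {x} → x ∈ xs → r ⊑ x
      deepest : ∀ {w} → (∀ {x} → x ∈ xs → w ⊑ x) → w ⊑ r

  ncaL-sound : ∀ xs {r} → ncaL xs ≡ just r → IsNCA xs r
  ncaL-sound xs@(x ∷ _) refl = record { common = common ; deepest = deepest }
    where
    open LastSatisfying (λ w → allL (isAnc w) xs)
    r : V
    r = foldl pick zero allV
    isCommon : ∀ {w} → T (allL (isAnc w) xs) ⇔ (∀ {y} → y ∈ xs → w ⊑ y)
    isCommon {w} = mk⇔ (λ t {y} y∈ → to Anc⇔⊑ (to (T-allL (isAnc w) xs) t y∈)) fromCommon
      where
      fromCommon : (∀ {y} → y ∈ xs → w ⊑ y) → T (allL (isAnc w) xs)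
      fromCommon h = from (T-allL (isAnc w) xs) (λ y∈ → from Anc⇔⊑ (h y∈))
    common : ∀ {y} → y ∈ xs → r ⊑ y
    common = to isCommon (foldl-pick-q zero allV (from isCommon (λ {y} _ → root⊑ y)))
    deepest : ∀ {w} → (∀ {y} → y ∈ xs → w ⊑ y) → w ⊑ r
    deepest {w} w⊑xs with ⊑-comparable (w⊑xs (here refl)) (common (here refl))
    ... | inj₁ w⊑r = w⊑r
    ... | inj₂ r⊑w = subst (_⊑ r) (Finₚ.≤-antisym (⊑⇒≤ r⊑w) w≤r) here
      where
      w≤r : w ≤ r
      w≤r = foldl-pick-max zero allV (tabulate⁺-< id) (∈-allFin w) (from isCommon w⊑xs)

  ncaL-nonempty : ∀ xs {r} → ncaL xs ≡ just r → ∃ (_∈ xs)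
  ncaL-nonempty (x ∷ _) _ = x , here refl

  ncaL-defined : ∀ {xs x} → x ∈ xs → ∃ λ r → ncaL xs ≡ just r
  ncaL-defined {_ ∷ _} _ = _ , refl

module BackEdges (G : DFSGraph) where
  open GraphOps G
  open MinimumV tree
  open Ancestry tree

  head⊑tail : ∀ j → head j ⊑ tail j
  head⊑tail j = proj₁ (to PAnc⇔ (backEdge j))

  InB⇔ : ∀ {v j} → InB v j ⇔ (v ⊑ tail j × head j < v)
  InB⇔ {v} {j} = mk⇔
    (λ t → let v⊑t , h⊏v = to T-∧ t ; h⊑v , h≢v = to PAnc⇔ h⊏v in
           to Anc⇔⊑ v⊑t , ≤∧≢⇒< (⊑⇒≤ h⊑v) h≢v)
    (λ (v⊑t , h<v) → from T-∧ (from Anc⇔⊑ v⊑t , from PAnc⇔ (⊑-<⇒⊑ (head⊑tail j) v⊑t h<v , <⇒≢ h<v)))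

  ∈BL⇔ : ∀ {v j} → j ∈ BL v ⇔ InB v j
  ∈BL⇔ {v} {j} = mk⇔ (proj₂ ∘ ∈-filter⁻ (T? ∘ inB v) {xs = allE}) (∈-filter⁺ (T? ∘ inB v) (∈-allFin j))

  ∈tails⇔ : ∀ {v x} → x ∈ map tail (BL v) ⇔ ∃ λ j → InB v j × x ≡ tail j
  ∈tails⇔ = mk⇔ (λ x∈ → let j , j∈ , x≡ = ∈-map⁻ tail x∈ in j , to ∈BL⇔ j∈ , x≡)
                (λ { (j , t , refl) → ∈-map⁺ tail (from ∈BL⇔ t) })

  M-common : ∀ {v r j} → M v ≡ just r → InB v j → r ⊑ tail j
  M-common {v} eq t = IsNCA.common (ncaL-sound _ eq) (from ∈tails⇔ (_ , t , refl))

  M-top : ∀ {v r} → M v ≡ just r → v ⊑ r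
  M-top {v} eq = IsNCA.deepest (ncaL-sound _ eq) λ x∈ →
    let j , t , x≡ = to ∈tails⇔ x∈ in subst (v ⊑_) (sym x≡) (proj₁ (to InB⇔ t))

  low1≤head : ∀ {w j} → InB w j → low1 w ≤ head j
  low1≤head t = minimumV-≤ _ _ (∈-map⁺ head (from ∈BL⇔ t))

  low1-attained : ∀ {w} → low1 w < w → ∃ λ j → InB w j × head j ≡ low1 w
  low1-attained {w} low1<w with minimumV-∈ w (map head (BL w))
  ... | here low1≡w = contradiction low1≡w (<⇒≢ low1<w)
  ... | there p = let j , j∈ , low1≡ = ∈-map⁻ head p in j , to ∈BL⇔ j∈ , sym low1≡

  l1≤head : ∀ {w j} → tail j ≡ w → l1 w ≤ head j
  l1≤head {w} {j} tail≡w =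
    minimumV-≤ w _ (∈-map⁺ head (∈-filter⁺ (T? ∘ λ j → tail j == w) (∈-allFin j) (fromWitness tail≡w)))

  firstWith-just : ∀ (p : Fin k → Bool) {xs x} → x ∈ xs → T (p x) →
                   ∃ λ e → firstWith p xs ≡ just e × e ∈ xs × T (p e)
  firstWith-just p {y ∷ ys} x∈ px with p y in eq
  ... | true = y , refl , here refl , subst T (sym eq) tt
  firstWith-just p {y ∷ ys} (here refl) px | false = ⊥-elim (subst T eq px)
  firstWith-just p {y ∷ ys} (there x∈)  px | false =
    let e , first≡ , e∈ , pe = firstWith-just p x∈ px in e , first≡ , there e∈ , pe

  low1Edge-attained : ∀ {w} → low1 w < w → ∃ λ e → low1Edge w ≡ just e × InB w e × head e ≡ low1 w
  low1Edge-attained low1<w =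
    let j , t , head≡ = low1-attained low1<w
        e , first≡ , e∈ , pe = firstWith-just _ (from ∈BL⇔ t) (fromWitness head≡)
    in e , first≡ , to ∈BL⇔ e∈ , toWitness pe

  notFixed-either : ∀ f {i j} → i ≢ j → T (notFixed f i) ⊎ T (notFixed f j)
  notFixed-either nothing  _ = inj₁ tt
  notFixed-either (just e) {i} {j} i≢j with i ≟ e | j ≟ e
  ... | no _     | _        = inj₁ tt
  ... | yes _    | no _     = inj₂ tt
  ... | yes refl | yes refl = contradiction refl i≢j

  low2≤head : ∀ {w j} → InB w j → T (notFixed (low1Edge w) j) → low2 w ≤ head j
  low2≤head {w} t nf = minimumV-≤ w _ (∈-map⁺ head (∈-filter⁺ (T? ∘ notFixed (low1Edge w)) (from ∈BL⇔ t) nf))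

  ≤low2⇔ : ∀ {x w : V} → x ≤ w → (x ≤ low2 w ⇔ AtMostOne (λ j → InB w j × head j < x))
  ≤low2⇔ {x} {w} x≤w = mk⇔ atMostOne ≤low2
    where
    atMostOne : x ≤ low2 w → AtMostOne (λ j → InB w j × head j < x)
    atMostOne x≤low2 {i} {j} (tᵢ , hᵢ<x) (tⱼ , hⱼ<x) with i ≟ j
    ... | yes i≡j = i≡j
    ... | no i≢j with notFixed-either (low1Edge w) i≢j
    ...   | inj₁ nfᵢ = contradiction (≤-<-trans (low2≤head tᵢ nfᵢ) hᵢ<x) (≤⇒≯ x≤low2)
    ...   | inj₂ nfⱼ = contradiction (≤-<-trans (low2≤head tⱼ nfⱼ) hⱼ<x) (≤⇒≯ x≤low2)
    ≤low2 : AtMostOne (λ j → InB w j × head j < x) → x ≤ low2 w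
    ≤low2 atMostOne with x ≤? low2 w
    ... | yes x≤low2 = x≤low2
    ... | no x≰low2 with minimumV-∈ w (map head (filterᵇ (notFixed (low1Edge w)) (BL w)))
    ...   | here low2≡w = contradiction (subst (x ≤_) (sym low2≡w) x≤w) x≰low2
    ...   | there low2∈ =
      -- the edge realising low2 w and the fixed edge realising low1 w are distinct, and both lie below x
      let j , j∈ , low2≡head = ∈-map⁻ head low2∈
          j∈B , j-not-fixed = ∈-filter⁻ (T? ∘ notFixed (low1Edge w)) {xs = BL w} j∈
          tⱼ = to ∈BL⇔ j∈B
          hⱼ<x = subst (_< x) low2≡head (≰⇒> x≰low2)
          low1<x = ≤-<-trans (low1≤head tⱼ) hⱼ<x
          e , low1Edge≡e , tₑ , hₑ≡low1 = low1Edge-attained (<-≤-trans low1<x x≤w)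
          j≡e = atMostOne (tⱼ , hⱼ<x) (tₑ , subst (_< x) (sym hₑ≡low1) low1<x)
      in contradiction j≡e (toWitnessFalse (subst (λ f → T (notFixed f j)) low1Edge≡e j-not-fixed))

module SubtreeNCA (G : DFSGraph) (ord : ChildOrder G) where
  open OrderOps G ord
  open Ancestry tree
  open BackEdges G

  InBT : V → V → Fin k → Set
  InBT v c j = InB v j × c ⊑ tail j

  ∈subtreeTails⇔ : ∀ {v c x} → x ∈ filterᵇ (isAnc c) (map tail (BL v)) ⇔ ∃ λ j → InBT v c j × x ≡ tail j
  ∈subtreeTails⇔ {v} {c} = mk⇔
    (λ x∈ → let x∈tails , c⊑x = ∈-filter⁻ (T? ∘ isAnc c) {xs = map tail (BL v)} x∈
                j , t , x≡ = to ∈tails⇔ x∈tails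
            in j , (t , subst (c ⊑_) x≡ (to Anc⇔⊑ c⊑x)) , x≡)
    (λ { (j , (t , c⊑t) , refl) → ∈-filter⁺ (T? ∘ isAnc c) (from ∈tails⇔ (j , t , refl)) (from Anc⇔⊑ c⊑t) })

  McT-common : ∀ {v c r j} → McT v c ≡ just r → InBT v c j → r ⊑ tail j
  McT-common eq t = IsNCA.common (ncaL-sound _ eq) (from ∈subtreeTails⇔ (_ , t , refl))

  McT-top : ∀ {v c r} → McT v c ≡ just r → c ⊑ r
  McT-top {c = c} eq = IsNCA.deepest (ncaL-sound _ eq) λ x∈ →
    let j , (_ , c⊑t) , x≡ = to ∈subtreeTails⇔ x∈ in subst (c ⊑_) (sym x≡) c⊑t

  McT-nonempty : ∀ {v c r} → McT v c ≡ just r → ∃ (InBT v c)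
  McT-nonempty eq = let x , x∈ = ncaL-nonempty _ eq ; j , t , _ = to ∈subtreeTails⇔ x∈ in j , t

  McT-defined : ∀ {v c j} → InBT v c j → ∃ λ r → McT v c ≡ just r
  McT-defined t = ncaL-defined (from ∈subtreeTails⇔ (_ , t , refl))

module Lemma8 (G : DFSGraph) (ord : ChildOrder G) where
  open OrderOps G ord
  open Ancestry tree
  open BackEdges G
  open SubtreeNCA G ord

  record SecondChild (cs : List V) (v m : V) : Set where
    field
      c1 c2     : V
      rest      : List V
      children≡ : cs ≡ c1 ∷ c2 ∷ rest
      McT-c2≡   : McT v c2 ≡ just m

  secondChild : ∀ {v m} cs → (nth cs 1 >>= McT v) ≡ just m → SecondChild cs v m
  secondChild (c1 ∷ c2 ∷ rest) McT≡ = record { c1 = c1 ; c2 = c2 ; rest = rest ; children≡ = refl ; McT-c2≡ = McT≡ }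

  module Assuming (v Mv m u : V) (M≡ : M v ≡ just Mv) (v≤l1 : v ≤ l1 Mv) (Mlow2≡ : Mlow2 v ≡ just m)
                  (Mu≡ : M u ≡ just m) (v<u : v < u) where

    open SecondChild (secondChild (children Mv) (trans (cong (_>>= λ w → c₂ w >>= McT v) (sym M≡)) Mlow2≡))

    Mlow1≡ : Mlow1 v ≡ McT v c1
    Mlow1≡ = trans (cong (_>>= λ w → c₁ w >>= McT v) M≡) (cong (λ cs → nth cs 0 >>= McT v) children≡)

    ∈children⇔ : ∀ {c} → c ∈ c1 ∷ c2 ∷ rest ⇔ IsChild Mv c
    ∈children⇔ {c} = complete Mv c ⇔-∘ mk⇔ (subst (c ∈_) (sym children≡)) (subst (c ∈_) children≡)

    child₁ : IsChild Mv c1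
    child₁ = to ∈children⇔ (here refl)

    child₂ : IsChild Mv c2
    child₂ = to ∈children⇔ (there (here refl))

    distinct : AllPairs _≢_ (c1 ∷ c2 ∷ rest)
    distinct = subst (AllPairs _≢_) children≡ (unique Mv)

    c1≢c2 : c1 ≢ c2
    c1≢c2 with distinct
    ... | (c1≢c2 ∷ _) ∷ _ = c1≢c2

    c1∉rest : ∀ {c} → c ∈ rest → c1 ≢ c
    c1∉rest c∈ with distinct
    ... | (_ ∷ c1≢rest) ∷ _ = All.lookup c1≢rest c∈

    c2∉rest : ∀ {c} → c ∈ rest → c2 ≢ c
    c2∉rest c∈ with distinct
    ... | _ ∷ c2≢rest ∷ _ = All.lookup c2≢rest c∈

    low1-sorted : AllPairs (λ a b → low1 a ≤ low1 b) (c1 ∷ c2 ∷ rest)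
    low1-sorted = Linked⇒AllPairs ≤-trans (subst (Linked _) children≡ (sorted Mv))

    v⊑child : ∀ {c} → IsChild Mv c → v ⊑ c
    v⊑child ch = ⊑-trans (M-top M≡) (child⊑ ch)

    v<child : ∀ {c} → IsChild Mv c → v < c
    v<child ch = ≤-<-trans (⊑⇒≤ (M-top M≡)) (child< ch)

    B-v-below-child : ∀ {j} → InB v j → ∃ λ c → IsChild Mv c × c ⊑ tail j
    B-v-below-child {j} t = ⊑-child (M-common M≡ t) Mv≢tail
      where
      Mv≢tail : Mv ≢ tail j
      Mv≢tail Mv≡tail = <⇒≱ (proj₂ (to InB⇔ t)) (≤-trans v≤l1 (l1≤head (sym Mv≡tail)))

    InBT⇔ : ∀ {c j} → IsChild Mv c → InBT v c j ⇔ (InB c j × head j < v)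
    InBT⇔ ch = mk⇔
      (λ (t , c⊑t) → let h<v = proj₂ (to InB⇔ t) in from InB⇔ (c⊑t , <-trans h<v (v<child ch)) , h<v)
      (λ (t , h<v) → let c⊑t = proj₁ (to InB⇔ t) in from InB⇔ (⊑-trans (v⊑child ch) c⊑t , h<v) , c⊑t)

    low1<v⇔ : ∀ {c} → IsChild Mv c → low1 c < v ⇔ ∃ (InBT v c)
    low1<v⇔ ch = mk⇔
      (λ low1<v → let j , t , h≡ = low1-attained (<-trans low1<v (v<child ch)) in
                  j , from (InBT⇔ ch) (t , subst (_< v) (sym h≡) low1<v))
      (λ (j , t) → let tc , h<v = to (InBT⇔ ch) t in ≤-<-trans (low1≤head tc) h<v)

    InBT-c1-nonempty : ∃ (InBT v c1)
    InBT-c1-nonempty with low1-sorted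
    ... | (low1-c1≤c2 ∷ _) ∷ _ =
      to (low1<v⇔ child₁) (≤-<-trans low1-c1≤c2 (from (low1<v⇔ child₂) (McT-nonempty McT-c2≡)))

    InBT-c2⇒B-u : ∀ {j} → InBT v c2 j → InB u j
    InBT-c2⇒B-u t = from InB⇔ (⊑-trans (M-top Mu≡) (McT-common McT-c2≡ t) , <-trans (proj₂ (to InB⇔ (proj₁ t))) v<u)

    B-u-outside-c2 : ∀ {c j} → IsChild Mv c → c ≢ c2 → c ⊑ tail j → ¬ InB u j
    B-u-outside-c2 ch c≢c2 c⊑t tu =
      c≢c2 (children-disjoint ch child₂ c⊑t (⊑-trans (McT-top McT-c2≡) (M-common Mu≡ tu)))

    low2-condition⇔ : (∃ λ w → Mlow1 v ≡ just w × v ≤ low2 w) ⇔ AtMostOne (InBT v c1)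
    low2-condition⇔ = mk⇔ unique-c1-edge low2-bound
      where
      ≤low2⇔unique : ∀ {w} → McT v c1 ≡ just w → v ≤ low2 w ⇔ AtMostOne (InBT v c1)
      ≤low2⇔unique {w} McT≡w = AtMostOne-cong below-v⇔ ⇔-∘ ≤low2⇔ (⊑⇒≤ v⊑w)
        where
        c1⊑w : c1 ⊑ w
        c1⊑w = McT-top McT≡w
        v⊑w : v ⊑ w
        v⊑w = ⊑-trans (v⊑child child₁) c1⊑w
        below-v⇔ : ∀ {j} → (InB w j × head j < v) ⇔ InBT v c1 j
        below-v⇔ = mk⇔
          (λ (t , h<v) → let w⊑t = proj₁ (to InB⇔ t) in from InB⇔ (⊑-trans v⊑w w⊑t , h<v) , ⊑-trans c1⊑w w⊑t)
          (λ (t , c1⊑t) → let h<v = proj₂ (to InB⇔ t) in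
                          from InB⇔ (McT-common McT≡w (t , c1⊑t) , <-≤-trans h<v (⊑⇒≤ v⊑w)) , h<v)
      unique-c1-edge : (∃ λ w → Mlow1 v ≡ just w × v ≤ low2 w) → AtMostOne (InBT v c1)
      unique-c1-edge (w , Mlow1≡w , v≤low2) = to (≤low2⇔unique (trans (sym Mlow1≡) Mlow1≡w)) v≤low2
      low2-bound : AtMostOne (InBT v c1) → ∃ λ w → Mlow1 v ≡ just w × v ≤ low2 w
      low2-bound c1-unique = let w , McT≡w = McT-defined (proj₂ InBT-c1-nonempty) in
                             w , trans Mlow1≡ McT≡w , from (≤low2⇔unique McT≡w) c1-unique

    c₃-condition⇔ : ((c₃ Mv ≡ nothing) ⊎ (∃ λ c → c₃ Mv ≡ just c × v ≤ low1 c)) ⇔ (∀ {c} → c ∈ rest → v ≤ low1 c)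
    c₃-condition⇔ with low1-sorted
    ... | _ ∷ _ ∷ sorted-rest = go rest (cong (λ cs → nth cs 2) children≡) sorted-rest
      where
      go : ∀ cs → c₃ Mv ≡ nth cs 0 → AllPairs (λ a b → low1 a ≤ low1 b) cs →
           ((c₃ Mv ≡ nothing) ⊎ (∃ λ c → c₃ Mv ≡ just c × v ≤ low1 c)) ⇔ (∀ {c} → c ∈ cs → v ≤ low1 c)
      go []       c₃≡ _ = mk⇔ (λ _ ()) (λ _ → inj₁ c₃≡)
      go (c3 ∷ cs) c₃≡ (c3≤cs ∷ _) = mk⇔ bounded (λ h → inj₂ (c3 , c₃≡ , h (here refl)))
        where
        bounded : (c₃ Mv ≡ nothing) ⊎ (∃ λ c → c₃ Mv ≡ just c × v ≤ low1 c) → ∀ {c} → c ∈ c3 ∷ cs → v ≤ low1 c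
        bounded (inj₁ c₃≡nothing) = contradiction (trans (sym c₃≡) c₃≡nothing) λ ()
        bounded (inj₂ (c , c₃≡c , v≤low1)) with just-injective (trans (sym c₃≡) c₃≡c)
        ... | refl = λ { (here refl) → v≤low1 ; (there c∈) → ≤-trans v≤low1 (All.lookup c3≤cs c∈) }

    extra-edge⇒conditions : (∃ λ e → InB v e × ¬ InB u e × (∀ j → InB v j → InB u j ⊎ j ≡ e))
                            → AtMostOne (InBT v c1) × (∀ {c} → c ∈ rest → v ≤ low1 c)
    extra-edge⇒conditions (e , _ , _ , B-v⊆) =
      (λ t t′ → trans (is-e child₁ c1≢c2 t) (sym (is-e child₁ c1≢c2 t′))) , rest-high
      where
      is-e : ∀ {c j} → IsChild Mv c → c ≢ c2 → InBT v c j → j ≡ e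
      is-e ch c≢c2 (t , c⊑t) = [ (λ tu → contradiction tu (B-u-outside-c2 ch c≢c2 c⊑t)) , id ] (B-v⊆ _ t)
      rest-high : ∀ {c} → c ∈ rest → v ≤ low1 c
      rest-high c∈ = ≮⇒≥ λ low1<v →
        let ch = to ∈children⇔ (there (there c∈))
            j , tⱼ = to (low1<v⇔ ch) low1<v
            e₁ , t₁ = InBT-c1-nonempty
            e₁≡j = trans (is-e child₁ c1≢c2 t₁) (sym (is-e ch (c2∉rest c∈ ∘ sym) tⱼ))
        in c1∉rest c∈ (children-disjoint child₁ ch (subst (λ x → c1 ⊑ tail x) e₁≡j (proj₂ t₁)) (proj₂ tⱼ))

    conditions⇒extra-edge : AtMostOne (InBT v c1) × (∀ {c} → c ∈ rest → v ≤ low1 c)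
                            → ∃ λ e → InB v e × ¬ InB u e × (∀ j → InB v j → InB u j ⊎ j ≡ e)
    conditions⇒extra-edge (c1-unique , rest-high) with InBT-c1-nonempty
    ... | e₁ , t₁ , c1⊑e₁ = e₁ , t₁ , B-u-outside-c2 child₁ c1≢c2 c1⊑e₁ , B-v⊆
      where
      B-v⊆ : ∀ j → InB v j → InB u j ⊎ j ≡ e₁
      B-v⊆ j t with B-v-below-child t
      ... | c , ch , c⊑t with from ∈children⇔ ch
      ...   | here refl         = inj₂ (c1-unique (t , c⊑t) (t₁ , c1⊑e₁))
      ...   | there (here refl) = inj₁ (InBT-c2⇒B-u (t , c⊑t))
      ...   | there (there c∈)  = contradiction (from (low1<v⇔ ch) (j , t , c⊑t)) (≤⇒≯ (rest-high c∈))

lemma8 : (G : DFSGraph) → (ord : ChildOrder G) →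
  let open OrderOps G ord in
  ThreeEdgeConnected →
  (v Mv m u : V) →
  M v ≡ just Mv → v ≤ l1 Mv →
  Mlow2 v ≡ just m →
  M u ≡ just m → v < u → (∀ w → M w ≡ just m → v < w → u ≤ w) →
  (Σ (Fin k) (λ e → (∀ j → InB v j ⇔ (InB u j ⊎ j ≡ e)) × ¬ InB u e))
  ⇔
  ((b-count v ≡ suc (b-count u))
   × (∃ λ w → (Mlow1 v ≡ just w) × (v ≤ low2 w))
   × ((c₃ Mv ≡ nothing) ⊎ (∃ λ c → (c₃ Mv ≡ just c) × (v ≤ low1 c))))
lemma8 G ord _ v Mv m u M≡ v≤l1 Mlow2≡ Mu≡ v<u _ = mk⇔
  (λ (e , B-v⇔ , e∉u) →
    let c1-unique , rest-high = extra-edge⇒conditions (e , from (B-v⇔ e) (inj₂ refl) , e∉u , to ∘ B-v⇔)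
    in count-insert B-v⇔ e∉u , from low2-condition⇔ c1-unique , from c₃-condition⇔ rest-high)
  (λ (count≡ , low2-cond , c₃-cond) →
    let e , e∈v , e∉u , B-v⊆ = conditions⇒extra-edge (to low2-condition⇔ low2-cond , to c₃-condition⇔ c₃-cond)
    in e , (λ j → mk⇔ (B-v⊆ j) [ count≡suc⇒⊇ B-v⊆ count≡ j , (λ { refl → e∈v }) ]) , e∉u)
  where
  open Lemma8.Assuming G ord v Mv m u M≡ v≤l1 Mlow2≡ Mu≡ v<u
  open Counting using (count-insert; count≡suc⇒⊇)
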